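{- Let $\vec G$ be an orientation of a complete bipartite graph with parts $V_0, V_1$, where $|V_0|=|V_1|=m$ and $m$ is divisible by $4$. Then there exists $i\in\{0,1\}$ such that $V_i$ contains at least $m/2+1$ vertices $v$ with $d^+(v,V_{1-i}) \geq m/4$.
   Context: For a vertex $v$ and a vertex set $X$ in a directed graph, $d^+(v,X) = |N^+(v)\cap X|$, where $N^+(v)$ is the set of out-neighbours of $v$ (vertices $u$ such that the arc between $u$ and $v$ is oriented from $v$ to $u$). -}

module Defs where

open import Data.Nat using (ℕ; _+_; _≤?_)
open import Data.Bool using (Bool; true; false; not)
open import Data.Fin using (Fin)
open import Data.List using (List; length; filter)
open import Data.List using (allFin)

-- An orientation of the complete bipartite graph K_{m,m} with parts
-- V0 = Fin m and V1 = Fin m: for u ∈ V0, w ∈ V1,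
-- orient u w ≡ true  means the arc is u → w,
-- orient u w ≡ false means the arc is w → u.
Orientation : ℕ → Set
Orientation m = Fin m → Fin m → Bool

count : (m : ℕ) → (Fin m → Bool) → ℕ
count m p = length (filter (λ x → Data.Bool.T? (p x)) (allFin m))
  where import Data.Bool

outdeg₀ : {m : ℕ} → Orientation m → Fin m → ℕ
outdeg₀ {m} o u = count m (λ w → o u w)

outdeg₁ : {m : ℕ} → Orientation m → Fin m → ℕ
outdeg₁ {m} o w = count m (λ u → not (o u w))

outdeg : {m : ℕ} → Orientation m → Fin 2 → Fin m → ℕ
outdeg o Fin.zero = outdeg₀ o
outdeg o (Fin.suc _) = outdeg₁ o

countLarge : {m : ℕ} → Orientation m → Fin 2 → ℕ → ℕ
countLarge {m} o i t = count m (λ v → Data.Nat._≤ᵇ_ t (outdeg o i v))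
  where import Data.Nat

-- Suppose neither part has 2k + 1 vertices of out-degree ≥ k into the other
-- part. Then each part contains a set of at least 2k "small" vertices, A ⊆ V₀
-- and B ⊆ V₁, each of out-degree ≤ k - 1. Every one of the |A||B| arcs between
-- A and B leaves a small vertex, so |A||B| ≤ (|A| + |B|)(k - 1); but
-- |A|, |B| ≥ 2k forces |A||B| ≥ (|A| + |B|)k.
module Submission where

open import Defs
open import Data.Nat using (ℕ; _*_; _+_; _≤_)
open import Data.Fin using (Fin)
open import Data.Product using (∃-syntax)

open import Data.Bool using (Bool; true; false; not; T; T?)
open import Data.Empty using (⊥-elim)
open import Data.Fin using (zero; suc)
open import Data.Fin.Patterns using (0F; 1F)
open import Data.List using (length; filter; tabulate)
open import Data.Nat using (zero; suc; _<_; _≤ᵇ_; _≤?_; z≤n; s≤s)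
open import Data.Nat.Properties
open import Algebra.Properties.Semiring.Sum +-*-semiring
  using (sum; sum-syntax; sum-cong-≗; ∑-comm; ∑-distrib-+; *-distribˡ-sum; *-distribʳ-sum)
open import Data.Nat.Solver using (module +-*-Solver)
open import Data.Product using (_,_)
open import Function using (_∘_)
open import Relation.Nullary using (yes; no; ¬_)
open import Relation.Binary.PropositionalEquality
  using (_≡_; refl; sym; trans; cong; cong₂; subst)

indicator : Bool → ℕ
indicator true  = 1
indicator false = 0

∑-mono-≤ : ∀ {n} {f g : Fin n → ℕ} → (∀ i → f i ≤ g i) → sum f ≤ sum g
∑-mono-≤ {zero}  f≤g = z≤n
∑-mono-≤ {suc n} f≤g = +-mono-≤ (f≤g zero) (∑-mono-≤ (f≤g ∘ suc))

length-filter-tabulate : ∀ {A : Set} {n} (p : A → Bool) (f : Fin n → A) →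
  length (filter (T? ∘ p) (tabulate f)) ≡ ∑[ i < n ] indicator (p (f i))
length-filter-tabulate {n = zero}  p f = refl
length-filter-tabulate {n = suc n} p f with p (f zero)
... | true  = cong suc (length-filter-tabulate p (f ∘ suc))
... | false = length-filter-tabulate p (f ∘ suc)

count≡∑ : ∀ m (p : Fin m → Bool) → count m p ≡ ∑[ i < m ] indicator (p i)
count≡∑ m p = length-filter-tabulate p (λ i → i)

count+count-not : ∀ m (p : Fin m → Bool) → count m p + count m (not ∘ p) ≡ m
count+count-not m p
  rewrite count≡∑ m p | count≡∑ m (not ∘ p) = ∑-complement m p
  where
  ∑-complement : ∀ n (q : Fin n → Bool) →
    ∑[ i < n ] indicator (q i) + ∑[ i < n ] indicator (not (q i)) ≡ n
  ∑-complement zero    q = refl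
  ∑-complement (suc n) q with q zero
  ... | true  = cong suc (∑-complement n (q ∘ suc))
  ... | false = trans (+-suc _ _) (cong suc (∑-complement n (q ∘ suc)))

-- Each pair (u , w) with p u and q w is charged to u if r u w, and to w otherwise.
count*count≤ : ∀ {m n} (p : Fin m → Bool) (q : Fin n → Bool)
  (r : Fin m → Fin n → Bool) →
  count m p * count n q ≤
    ∑[ u < m ] (indicator (p u) * count n (r u)) +
    ∑[ w < n ] (indicator (q w) * count m (λ u → not (r u w)))
count*count≤ {m} {n} p q r = begin
  count m p * count n q
    ≡⟨ cong₂ _*_ (count≡∑ m p) (count≡∑ n q) ⟩
  (∑[ u < m ] [p] u) * (∑[ w < n ] [q] w)
    ≡⟨ *-distribʳ-sum _ [p] ⟩
  ∑[ u < m ] ([p] u * ∑[ w < n ] [q] w)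
    ≡⟨ sum-cong-≗ (λ u → *-distribˡ-sum ([p] u) [q]) ⟩
  ∑[ u < m ] ∑[ w < n ] ([p] u * [q] w)
    ≤⟨ ∑-mono-≤ (λ u → ∑-mono-≤ (λ w → charge (p u) (q w) (r u w))) ⟩
  ∑[ u < m ] ∑[ w < n ] ([p] u * [r] u w + [q] w * [¬r] u w)
    ≡⟨ sum-cong-≗ (λ u → ∑-distrib-+ (λ w → [p] u * [r] u w) (λ w → [q] w * [¬r] u w)) ⟩
  ∑[ u < m ] (∑[ w < n ] ([p] u * [r] u w) + ∑[ w < n ] ([q] w * [¬r] u w))
    ≡⟨ ∑-distrib-+ (λ u → ∑[ w < n ] ([p] u * [r] u w)) (λ u → ∑[ w < n ] ([q] w * [¬r] u w)) ⟩
  ∑[ u < m ] ∑[ w < n ] ([p] u * [r] u w) + ∑[ u < m ] ∑[ w < n ] ([q] w * [¬r] u w)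
    ≡⟨ cong₂ _+_ (sum-cong-≗ (λ u → sym (*-distribˡ-sum ([p] u) ([r] u))))
                 (∑-comm (λ u w → [q] w * [¬r] u w)) ⟩
  ∑[ u < m ] ([p] u * ∑[ w < n ] [r] u w) + ∑[ w < n ] ∑[ u < m ] ([q] w * [¬r] u w)
    ≡⟨ cong₂ _+_ (sum-cong-≗ (λ u → cong ([p] u *_) (sym (count≡∑ n (r u)))))
                 (sum-cong-≗ (λ w → sym (*-distribˡ-sum ([q] w) (λ u → [¬r] u w)))) ⟩
  ∑[ u < m ] ([p] u * count n (r u)) + ∑[ w < n ] ([q] w * ∑[ u < m ] [¬r] u w)
    ≡⟨ cong (∑[ u < m ] ([p] u * count n (r u)) +_) (sum-cong-≗ (λ w → cong ([q] w *_)
                              (sym (count≡∑ m (λ u → not (r u w)))))) ⟩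
  ∑[ u < m ] ([p] u * count n (r u)) + ∑[ w < n ] ([q] w * count m (λ u → not (r u w)))
    ∎
  where
  open ≤-Reasoning
  [p] = indicator ∘ p
  [q] = indicator ∘ q
  [r] = λ u → indicator ∘ r u
  [¬r] = λ u w → indicator (not (r u w))
  charge : ∀ a b c →
    indicator a * indicator b ≤ indicator a * indicator c + indicator b * indicator (not c)
  charge false b     c     = z≤n
  charge true  false c     = z≤n
  charge true  true  true  = s≤s z≤n
  charge true  true  false = s≤s z≤n

indicator-*-mono-≤ : ∀ b {x y} → (T b → x ≤ y) → indicator b * x ≤ indicator b * y
indicator-*-mono-≤ true  x≤y = *-monoʳ-≤ 1 (x≤y _)
indicator-*-mono-≤ false x≤y = z≤n

∑-indicator-*-≤ : ∀ {m} (p : Fin m → Bool) (d : Fin m → ℕ) t →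
  (∀ u → T (p u) → d u ≤ t) → ∑[ u < m ] (indicator (p u) * d u) ≤ count m p * t
∑-indicator-*-≤ {m} p d t d≤t = begin
  ∑[ u < m ] (indicator (p u) * d u)  ≤⟨ ∑-mono-≤ (λ u → indicator-*-mono-≤ (p u) (d≤t u)) ⟩
  ∑[ u < m ] (indicator (p u) * t)    ≡⟨ *-distribʳ-sum t (indicator ∘ p) ⟨
  (∑[ u < m ] indicator (p u)) * t    ≡⟨ cong (_* t) (count≡∑ m p) ⟨
  count m p * t                       ∎
  where open ≤-Reasoning

T-not-≤ᵇ⇒> : ∀ m n → T (not (m ≤ᵇ n)) → n < m
T-not-≤ᵇ⇒> m n m≰ᵇn with m ≤ᵇ n in eq
... | false = ≰⇒> (λ m≤n → subst T eq (≤⇒≤ᵇ m≤n))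

m*j+n*j<m*n : ∀ {j m n} → 2 * suc j ≤ m → 2 * suc j ≤ n → m * j + n * j < m * n
m*j+n*j<m*n {j} {m} {n} 2[1+j]≤m 2[1+j]≤n = *-cancelˡ-< 2 _ _ (begin-strict
  2 * (m * j + n * j)                     <⟨ m<m+n _ 0<2[m+n] ⟩
  2 * (m * j + n * j) + 2 * (m + n)       ≡⟨ regroup m n j ⟩
  m * (2 * suc j) + n * (2 * suc j)       ≤⟨ +-mono-≤ (*-monoʳ-≤ m 2[1+j]≤n) (*-monoʳ-≤ n 2[1+j]≤m) ⟩
  m * n + n * m                           ≡⟨ double m n ⟩
  2 * (m * n)                             ∎)
  where
  open ≤-Reasoning
  open +-*-Solver
  0<2[m+n] : 0 < 2 * (m + n)
  0<2[m+n] = ≤-trans (s≤s z≤n) (≤-trans 2[1+j]≤m (≤-trans (m≤m+n m n) (m≤m+n (m + n) _)))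
  regroup : ∀ m n j → 2 * (m * j + n * j) + 2 * (m + n) ≡ m * (2 * suc j) + n * (2 * suc j)
  regroup = solve 3 (λ m n j → con 2 :* (m :* j :+ n :* j) :+ con 2 :* (m :+ n)
                              := m :* (con 2 :* (con 1 :+ j)) :+ n :* (con 2 :* (con 1 :+ j))) refl
  double : ∀ m n → m * n + n * m ≡ 2 * (m * n)
  double = solve 2 (λ m n → m :* n :+ n :* m := con 2 :* (m :* n)) refl

small : ∀ {m} → Orientation m → Fin 2 → ℕ → Fin m → Bool
small o i t v = not (t ≤ᵇ outdeg o i v)

countSmall : ∀ {m} → Orientation m → Fin 2 → ℕ → ℕ
countSmall {m} o i t = count m (small o i t)

few-large⇒many-small : ∀ k (o : Orientation (4 * k)) i →
  ¬ (2 * k + 1 ≤ countLarge o i k) → 2 * k ≤ countSmall o i k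
few-large⇒many-small k o i few = +-cancelˡ-≤ (2 * k) _ _ (begin
  2 * k + 2 * k                         ≡⟨ *-distribʳ-+ k 2 2 ⟨
  4 * k                                 ≡⟨ count+count-not (4 * k) (λ v → k ≤ᵇ outdeg o i v) ⟨
  countLarge o i k + countSmall o i k   ≤⟨ +-monoˡ-≤ _ few⇒≤ ⟩
  2 * k + countSmall o i k              ∎)
  where
  open ≤-Reasoning
  few⇒≤ : countLarge o i k ≤ 2 * k
  few⇒≤ = m<1+n⇒m≤n (subst (countLarge o i k <_) (+-comm (2 * k) 1) (≰⇒> few))

countSmall*countSmall≤ : ∀ {m} j (o : Orientation m) →
  countSmall o 0F (suc j) * countSmall o 1F (suc j) ≤
    countSmall o 0F (suc j) * j + countSmall o 1F (suc j) * j
countSmall*countSmall≤ j o =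
  ≤-trans (count*count≤ (small o 0F (suc j)) (small o 1F (suc j)) o)
          (+-mono-≤ (∑-indicator-*-≤ (small o 0F (suc j)) (outdeg o 0F) j (small⇒outdeg≤ 0F))
                    (∑-indicator-*-≤ (small o 1F (suc j)) (outdeg o 1F) j (small⇒outdeg≤ 1F)))
  where
  small⇒outdeg≤ : ∀ i v → T (small o i (suc j) v) → outdeg o i v ≤ j
  small⇒outdeg≤ i v = m<1+n⇒m≤n ∘ T-not-≤ᵇ⇒> (suc j) (outdeg o i v)

lemma2 : (k : ℕ) → 1 ≤ k → (o : Orientation (4 * k)) →
    ∃[ i ] (2 * k + 1 ≤ countLarge o i k)
lemma2 (suc j) _ o
  with 2 * suc j + 1 ≤? countLarge o 0F (suc j) | 2 * suc j + 1 ≤? countLarge o 1F (suc j)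
... | yes many₀ | _         = 0F , many₀
... | no _      | yes many₁ = 1F , many₁
... | no few₀   | no few₁   =
  ⊥-elim (<⇒≱ (m*j+n*j<m*n (few-large⇒many-small (suc j) o 0F few₀)
                           (few-large⇒many-small (suc j) o 1F few₁))
              (countSmall*countSmall≤ j o))
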